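{- Let $n \geq m \geq 0$ and $p$ be integers with $p \geq n+2m+2$, and let $(B,R)$ be a partition of the edges of $K_p$ (on vertex set $[p]$) into two classes. Then $(B,R)$ is $(n,m)$-free if and only if for every $C \in \{B,R\}$ and every edge $uv \in C$, either $$|N_C(u) \cup N_C(v)| \leq n+m+1$$ or $$\deg_C(u) \leq n \ \text{ and } \ \deg_C(v) \leq n.$$
   Context: For integers $n \geq m \geq 0$, the double star $S(n,m)$ is the graph consisting of the union of two stars $K_{1,n}$ and $K_{1,m}$ together with an edge joining their centers. A partition $(B,R)$ of the edges of $K_p$ is called $(n,m)$-free if $K_p$ contains no copy of $S(n,m)$ all of whose edges belong to the same part of $(B,R)$. For $v \in [p]$ and $C \in \{B,R\}$, $N_C(v)$ denotes the set of vertices joined to $v$ by edges in $C$, and $\deg_C(v)=|N_C(v)|$. -}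

module Defs where

open import Data.Nat using (ℕ; _+_; _≤_)
open import Data.Fin using (Fin; _≟_)
open import Data.Fin.Subset using (Subset; _∪_; ∣_∣)
open import Data.Vec using (tabulate)
open import Data.Product using (_×_; Σ; _,_)
open import Data.Sum using (_⊎_)
open import Function.Definitions using (Injective)
open import Relation.Binary.PropositionalEquality using (_≡_; _≢_)
open import Relation.Nullary using (¬_; Dec; yes; no)
open import Relation.Nullary.Decidable using (⌊_⌋; _×-dec_; ¬?)

data Colour : Set where
  B R : Colour

_≟ᶜ_ : (c d : Colour) → Dec (c ≡ d)
B ≟ᶜ B = yes _≡_.refl
B ≟ᶜ R = no λ ()
R ≟ᶜ B = no λ ()
R ≟ᶜ R = yes _≡_.refl

-- A 2-edge-colouring of K_p on vertex set Fin p: the colour of edge {u,v}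
-- (u ≢ v) is col u v.  Values on the diagonal are irrelevant.
Colouring : ℕ → Set
Colouring p = Fin p → Fin p → Colour

Symmetric : ∀ {p} → Colouring p → Set
Symmetric {p} col = (u v : Fin p) → u ≢ v → col u v ≡ col v u

-- Vertices of the double star S(n,m): centre a (with n leaves), centre b
-- (with m leaves), leaves of a, leaves of b.
data DSVertex (n m : ℕ) : Set where
  ca cb : DSVertex n m
  la : Fin n → DSVertex n m
  lb : Fin m → DSVertex n m

data DSEdge {n m : ℕ} : DSVertex n m → DSVertex n m → Set where
  centre : DSEdge ca cb
  leafa  : (i : Fin n) → DSEdge ca (la i)
  leafb  : (j : Fin m) → DSEdge cb (lb j)

MonoDoubleStar : ∀ {p} → Colouring p → Colour → (n m : ℕ) → Set
MonoDoubleStar {p} col C n m =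
  Σ (DSVertex n m → Fin p) λ f →
    Injective _≡_ _≡_ f ×
    (∀ x y → DSEdge x y → col (f x) (f y) ≡ C)

Free : ∀ {p} → Colouring p → (n m : ℕ) → Set
Free col n m = (C : Colour) → ¬ MonoDoubleStar col C n m

N : ∀ {p} → Colouring p → Colour → Fin p → Subset p
N col C u = tabulate λ w → ⌊ ¬? (w ≟ u) ×-dec (col u w ≟ᶜ C) ⌋

deg : ∀ {p} → Colouring p → Colour → Fin p → ℕ
deg col C u = ∣ N col C u ∣

Condition : ∀ {p} → Colouring p → (n m : ℕ) → Set
Condition {p} col n m =
  (C : Colour) (u v : Fin p) → u ≢ v → col u v ≡ C →
    (∣ N col C u ∪ N col C v ∣ ≤ n + m + 1)
    ⊎ (deg col C u ≤ n × deg col C v ≤ n)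

module Submission where

-- Conversely (forcedStar), if the condition fails at a C-edge uv with
-- deg_C u > n, buildStar applies to uv unless deg_C v ≤ m. Then u has a
-- C-neighbour w ≠ v outside N_C v, and buildStar applies to uw unless
-- deg_C w ≤ n + m; in that case v and w both have many neighbours in the
-- other colour, and buildStar applies to the edge vw in that colour.

open import Defs
open import Data.Nat using (ℕ; zero; suc; _+_; _*_; _≤_; _<_; z≤n; s≤s; s≤s⁻¹; _≤?_; _<?_)
open import Data.Nat.Properties
  using (≤-trans; ≤-reflexive; <-≤-trans; ≤-<-trans; n≤1+n; +-suc; +-comm;
         +-monoʳ-≤; +-monoˡ-≤; +-cancelˡ-≤; +-cancelʳ-≤; m≤n+m; m≤m+n; <⇒≱; ≮⇒≥; ≰⇒>; module ≤-Reasoning)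
open import Data.Nat.Tactic.RingSolver using (solve-∀)
open import Data.Fin using (Fin; zero; suc; _≟_; splitAt; join)
open import Data.Fin.Properties using (suc-injective; join-splitAt)
open import Data.Fin.Subset
  using (Subset; inside; outside; _∈_; _∉_; _⊆_; _∪_; _─_; _-_; ⁅_⁆; ⊤; ∣_∣; Nonempty)
open import Data.Fin.Subset.Properties
  using (x∈p∪q⁺; x∈p∪q⁻; p⊆q⇒∣p∣≤∣q∣; p⊂q⇒∣p∣<∣q∣; p⊆p∪q; ∪-comm; x∈⁅x⁆;
         ∣⁅x⁆∣≡1; x∈p∧x≢y⇒x∈p-y; x∈p∧x∉q⇒x∈p─q; p─q⊆p; x∈p⇒∣p-x∣<∣p∣;
         ∣⊤∣≡n; _∈?_; nonempty?; Empty-unique; ∣⊥∣≡0)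
open import Data.Vec using (_∷_; []; tabulate; here; there)
open import Data.Vec.Properties using (lookup∘tabulate; []=⇒lookup; lookup⇒[]=)
open import Data.Vec.Functional using () renaming (_∷_ to _◂_)
open import Data.Bool.Properties using (T-≡)
open import Data.Product using (Σ; ∃; _×_; _,_; proj₁; proj₂; uncurry)
open import Data.Sum using (_⊎_; inj₁; inj₂; [_,_]′; fromInj₁)
open import Data.Empty using (⊥-elim)
open import Function using (_∘_)
open import Function.Bundles using (_⇔_; mk⇔; Equivalence)
open import Function.Definitions using (Injective)
open import Relation.Binary.PropositionalEquality
  using (_≡_; _≢_; refl; sym; trans; cong; subst)
open import Relation.Nullary using (Dec; yes; no)
open import Relation.Nullary.Decidable using (⌊_⌋; toWitness; fromWitness; ¬?; _×-dec_)

open Equivalence using (to; from)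

private
  variable
    k : ℕ

-- The n + m + 2 vertices of S(n,m) are more than n + m + 1.
n+m+1<2+n+m : ∀ n m → n + m + 1 < suc n + suc m
n+m+1<2+n+m n m = ≤-reflexive (eq n m)
  where
  eq : ∀ n m → suc (n + m + 1) ≡ suc n + suc m
  eq = solve-∀

-- p ≥ n + 2m + 2 exceeds both m + (n + m + 1) and (n + m) + (m + 1); these are
-- the two ways the degree sum deg_C x + deg_D x ≥ p - 1 is used.
room-after-m : ∀ {n m p} → n + 2 * m + 2 ≤ p → m + suc (n + m) < p
room-after-m {n} {m} = ≤-trans (≤-reflexive (eq n m))
  where
  eq : ∀ n m → suc (m + suc (n + m)) ≡ n + 2 * m + 2
  eq = solve-∀

room-after-n+m : ∀ {n m p} → n + 2 * m + 2 ≤ p → (n + m) + suc m < p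
room-after-n+m {n} {m} = ≤-trans (≤-reflexive (eq n m))
  where
  eq : ∀ n m → suc (n + m + suc m) ≡ n + 2 * m + 2
  eq = solve-∀

x∈p─q⇒x∉q : (p q : Subset k) {x : Fin k} → x ∈ p ─ q → x ∉ q
x∈p─q⇒x∉q (_ ∷ p) (outside ∷ q) here ()
x∈p─q⇒x∉q (_ ∷ p) (inside ∷ q) () here
x∈p─q⇒x∉q (_ ∷ p) (_ ∷ q) (there x∈p─q) (there x∈q) = x∈p─q⇒x∉q p q x∈p─q x∈q

x∈p-y⇒x≢y : {p : Subset k} {x y : Fin k} → x ∈ p - y → x ≢ y
x∈p-y⇒x≢y {p = p} {y = y} x∈p-y refl = x∈p─q⇒x∉q p ⁅ y ⁆ x∈p-y (x∈⁅x⁆ y)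

x∈p-y⇒x∈p : {p : Subset k} {x y : Fin k} → x ∈ p - y → x ∈ p
x∈p-y⇒x∈p {p = p} {y = y} = p─q⊆p p ⁅ y ⁆

∣p∪q∣≤∣p∣+∣q∣ : (p q : Subset k) → ∣ p ∪ q ∣ ≤ ∣ p ∣ + ∣ q ∣
∣p∪q∣≤∣p∣+∣q∣ []            []            = z≤n
∣p∪q∣≤∣p∣+∣q∣ (outside ∷ p) (outside ∷ q) = ∣p∪q∣≤∣p∣+∣q∣ p q
∣p∪q∣≤∣p∣+∣q∣ (outside ∷ p) (inside  ∷ q) =
  ≤-trans (s≤s (∣p∪q∣≤∣p∣+∣q∣ p q)) (≤-reflexive (sym (+-suc ∣ p ∣ ∣ q ∣)))
∣p∪q∣≤∣p∣+∣q∣ (inside  ∷ p) (outside ∷ q) = s≤s (∣p∪q∣≤∣p∣+∣q∣ p q)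
∣p∪q∣≤∣p∣+∣q∣ (inside  ∷ p) (inside  ∷ q) =
  s≤s (≤-trans (∣p∪q∣≤∣p∣+∣q∣ p q) (+-monoʳ-≤ ∣ p ∣ (n≤1+n ∣ q ∣)))

∣⁅x⁆∪p∣≤1+∣p∣ : (x : Fin k) (p : Subset k) → ∣ ⁅ x ⁆ ∪ p ∣ ≤ suc ∣ p ∣
∣⁅x⁆∪p∣≤1+∣p∣ x p = ≤-trans (∣p∪q∣≤∣p∣+∣q∣ ⁅ x ⁆ p) (≤-reflexive (cong (_+ ∣ p ∣) (∣⁅x⁆∣≡1 x)))

∣p∣≤1+∣p-x∣ : (p : Subset k) (x : Fin k) → ∣ p ∣ ≤ suc ∣ p - x ∣
∣p∣≤1+∣p-x∣ p x = ≤-trans (p⊆q⇒∣p∣≤∣q∣ p⊆⁅x⁆∪p-x) (∣⁅x⁆∪p∣≤1+∣p∣ x (p - x))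
  where
  p⊆⁅x⁆∪p-x : p ⊆ ⁅ x ⁆ ∪ (p - x)
  p⊆⁅x⁆∪p-x {y} y∈p with y ≟ x
  ... | yes refl = x∈p∪q⁺ (inj₁ (x∈⁅x⁆ x))
  ... | no y≢x   = x∈p∪q⁺ (inj₂ (x∈p∧x≢y⇒x∈p-y y∈p y≢x))

∣p∣<∣p∪q∣ : (p q : Subset k) {x : Fin k} → x ∈ q → x ∉ p → ∣ p ∣ < ∣ p ∪ q ∣
∣p∣<∣p∪q∣ p q {x} x∈q x∉p = p⊂q⇒∣p∣<∣q∣ (p⊆p∪q q , x , x∈p∪q⁺ (inj₂ x∈q) , x∉p)

nonempty : (p : Subset k) → 1 ≤ ∣ p ∣ → Nonempty p
nonempty {k} p 1≤∣p∣ with nonempty? p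
... | yes ne = ne
... | no empty with ≤-trans 1≤∣p∣ (≤-reflexive (trans (cong ∣_∣ (Empty-unique empty)) (∣⊥∣≡0 k)))
...   | ()

privatePoint : (p q : Subset k) (y : Fin k) → suc (suc ∣ q ∣) ≤ ∣ p ∪ q ∣ →
  ∃ λ x → x ∈ p × x ∉ q × x ≢ y
privatePoint {k} p q y q+2≤∣p∪q∣ with nonempty ((p ─ q) - y) 1≤∣X∣
  where
  open ≤-Reasoning
  X : Subset k
  X = (p ─ q) - y
  p∪q-y⊆X∪q : (p ∪ q) - y ⊆ X ∪ q
  p∪q-y⊆X∪q {z} z∈ with z ∈? q | x∈p∪q⁻ p q (x∈p-y⇒x∈p z∈)
  ... | yes z∈q | _        = x∈p∪q⁺ (inj₂ z∈q)
  ... | no z∉q  | inj₁ z∈p = x∈p∪q⁺ (inj₁ (x∈p∧x≢y⇒x∈p-y (x∈p∧x∉q⇒x∈p─q z∈p z∉q) (x∈p-y⇒x≢y z∈)))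
  ... | no z∉q  | inj₂ z∈q = ⊥-elim (z∉q z∈q)
  1≤∣X∣ : 1 ≤ ∣ X ∣
  1≤∣X∣ = +-cancelʳ-≤ (∣ q ∣) 1 (∣ X ∣) (s≤s⁻¹ (begin
    suc (suc ∣ q ∣)     ≤⟨ q+2≤∣p∪q∣ ⟩
    ∣ p ∪ q ∣           ≤⟨ ∣p∣≤1+∣p-x∣ (p ∪ q) y ⟩
    suc ∣ (p ∪ q) - y ∣ ≤⟨ s≤s (p⊆q⇒∣p∣≤∣q∣ p∪q-y⊆X∪q) ⟩
    suc ∣ X ∪ q ∣       ≤⟨ s≤s (∣p∪q∣≤∣p∣+∣q∣ X q) ⟩
    suc (∣ X ∣ + ∣ q ∣) ∎))
... | x , x∈X = x , p─q⊆p p q (x∈p-y⇒x∈p x∈X) , x∈p─q⇒x∉q p q (x∈p-y⇒x∈p x∈X) , x∈p-y⇒x≢y x∈X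

empty-injective : {f : Fin 0 → Fin k} → Injective _≡_ _≡_ f
empty-injective {x = ()}

◂-injective : {n : ℕ} {f : Fin n → Fin k} {b : Fin k} →
  Injective _≡_ _≡_ f → (∀ i → f i ≢ b) → Injective _≡_ _≡_ (b ◂ f)
◂-injective f-inj f≢b {zero}  {zero}  _ = refl
◂-injective f-inj f≢b {zero}  {suc j} b≡fj = ⊥-elim (f≢b j (sym b≡fj))
◂-injective f-inj f≢b {suc i} {zero}  fi≡b = ⊥-elim (f≢b i fi≡b)
◂-injective f-inj f≢b {suc i} {suc j} fi≡fj = cong suc (f-inj fi≡fj)

retraction⇒injective : {A B : Set} (f : A → B) (g : B → A) →
  (∀ x → g (f x) ≡ x) → Injective _≡_ _≡_ f
retraction⇒injective f g gf≡id {x} {y} fx≡fy =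
  trans (sym (gf≡id x)) (trans (cong g fx≡fy) (gf≡id y))

injection⇒≤∣p∣ : {n : ℕ} (p : Subset k) (f : Fin n → Fin k) →
  Injective _≡_ _≡_ f → (∀ i → f i ∈ p) → n ≤ ∣ p ∣
injection⇒≤∣p∣ {n = zero}  p f f-inj f∈p = z≤n
injection⇒≤∣p∣ {n = suc n} p f f-inj f∈p =
  ≤-<-trans (injection⇒≤∣p∣ (p - f zero) (f ∘ suc) (suc-injective ∘ f-inj) tail∈p-f0)
            (x∈p⇒∣p-x∣<∣p∣ (f∈p zero))
  where
  tail∈p-f0 : ∀ i → f (suc i) ∈ p - f zero
  tail∈p-f0 i = x∈p∧x≢y⇒x∈p-y (f∈p (suc i)) (λ fi≡f0 → 1+n≢0 (f-inj fi≡f0))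
    where
    1+n≢0 : suc i ≢ zero
    1+n≢0 ()

choose : {n : ℕ} (p : Subset k) → n ≤ ∣ p ∣ →
  Σ (Fin n → Fin k) λ f → Injective _≡_ _≡_ f × (∀ i → f i ∈ p)
choose {n = zero}  p _ = (λ ()) , empty-injective , λ ()
choose {n = suc n} p n<∣p∣ with nonempty p (≤-trans (s≤s z≤n) n<∣p∣)
... | x , x∈p with choose (p - x) (s≤s⁻¹ (≤-trans n<∣p∣ (∣p∣≤1+∣p-x∣ p x)))
...   | f , f-inj , f∈p-x =
  x ◂ f , ◂-injective f-inj (λ i → x∈p-y⇒x≢y (f∈p-x i)) , x◂f∈p
  where
  x◂f∈p : ∀ i → (x ◂ f) i ∈ p
  x◂f∈p zero    = x∈p
  x◂f∈p (suc i) = x∈p-y⇒x∈p (f∈p-x i)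

record DisjointChoice (S T : Subset k) (n m : ℕ) : Set where
  field
    left      : Fin n → Fin k
    right     : Fin m → Fin k
    left-inj  : Injective _≡_ _≡_ left
    right-inj : Injective _≡_ _≡_ right
    left∈S    : ∀ i → left i ∈ S
    right∈T   : ∀ j → right j ∈ T
    apart     : ∀ i j → left i ≢ right j

adjoinRight : {S T : Subset k} {n m : ℕ} {b : Fin k} → b ∈ T →
  DisjointChoice (S - b) (T - b) n m → DisjointChoice S T n (suc m)
adjoinRight {b = b} b∈T c = record
  { left      = left
  ; right     = b ◂ right
  ; left-inj  = left-inj
  ; right-inj = ◂-injective right-inj (λ j → x∈p-y⇒x≢y (right∈T j))
  ; left∈S    = x∈p-y⇒x∈p ∘ left∈S
  ; right∈T   = b◂right∈T
  ; apart     = apart′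
  }
  where
  open DisjointChoice c
  b◂right∈T : ∀ j → (b ◂ right) j ∈ _
  b◂right∈T zero    = b∈T
  b◂right∈T (suc j) = x∈p-y⇒x∈p (right∈T j)
  apart′ : ∀ i j → left i ≢ (b ◂ right) j
  apart′ i zero    = x∈p-y⇒x≢y (left∈S i)
  apart′ i (suc j) = apart i j

∣p∪q∣≤1+∣p-x∪q-x∣ : (p q : Subset k) (x : Fin k) → ∣ p ∪ q ∣ ≤ suc ∣ (p - x) ∪ (q - x) ∣
∣p∪q∣≤1+∣p-x∪q-x∣ p q x =
  ≤-trans (∣p∣≤1+∣p-x∣ (p ∪ q) x) (s≤s (p⊆q⇒∣p∣≤∣q∣ p∪q-x⊆p-x∪q-x))
  where
  p∪q-x⊆p-x∪q-x : (p ∪ q) - x ⊆ (p - x) ∪ (q - x)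
  p∪q-x⊆p-x∪q-x y∈ with x∈p∪q⁻ p q (x∈p-y⇒x∈p y∈)
  ... | inj₁ y∈p = x∈p∪q⁺ (inj₁ (x∈p∧x≢y⇒x∈p-y y∈p (x∈p-y⇒x≢y y∈)))
  ... | inj₂ y∈q = x∈p∪q⁺ (inj₂ (x∈p∧x≢y⇒x∈p-y y∈q (x∈p-y⇒x≢y y∈)))

∣p∪q∣≤2+∣p-y∪q-x∣ : (p q : Subset k) (x y : Fin k) →
  ∣ p ∪ q ∣ ≤ suc (suc ∣ (p - y) ∪ (q - x) ∣)
∣p∪q∣≤2+∣p-y∪q-x∣ p q x y = begin
  ∣ p ∪ q ∣                                  ≤⟨ p⊆q⇒∣p∣≤∣q∣ p∪q⊆ ⟩
  ∣ ⁅ x ⁆ ∪ (⁅ y ⁆ ∪ (p - y) ∪ (q - x)) ∣    ≤⟨ ∣⁅x⁆∪p∣≤1+∣p∣ x (⁅ y ⁆ ∪ (p - y) ∪ (q - x)) ⟩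
  suc ∣ ⁅ y ⁆ ∪ (p - y) ∪ (q - x) ∣          ≤⟨ s≤s (∣⁅x⁆∪p∣≤1+∣p∣ y ((p - y) ∪ (q - x))) ⟩
  suc (suc ∣ (p - y) ∪ (q - x) ∣)            ∎
  where
  open ≤-Reasoning
  p∪q⊆ : p ∪ q ⊆ ⁅ x ⁆ ∪ (⁅ y ⁆ ∪ (p - y) ∪ (q - x))
  p∪q⊆ {z} z∈ with z ≟ x | z ≟ y | x∈p∪q⁻ p q z∈
  ... | yes refl | _        | _        = x∈p∪q⁺ (inj₁ (x∈⁅x⁆ x))
  ... | no _     | yes refl | _        = x∈p∪q⁺ (inj₂ (x∈p∪q⁺ (inj₁ (x∈⁅x⁆ y))))
  ... | no _     | no z≢y   | inj₁ z∈p =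
    x∈p∪q⁺ (inj₂ (x∈p∪q⁺ (inj₂ (x∈p∪q⁺ (inj₁ (x∈p∧x≢y⇒x∈p-y z∈p z≢y))))))
  ... | no z≢x   | no _     | inj₂ z∈q =
    x∈p∪q⁺ (inj₂ (x∈p∪q⁺ (inj₂ (x∈p∪q⁺ (inj₂ (x∈p∧x≢y⇒x∈p-y z∈q z≢x))))))

-- If |T| > m and |S ∪ T| ≥ n + m + 1, some point of T can be removed from S
-- while keeping n points there: a point of T outside S if there is one,
-- otherwise T ⊆ S and |S| ≥ n + m + 1.
removablePoint : (S T : Subset k) {n m : ℕ} → n ≤ ∣ S ∣ → suc m ≤ ∣ T ∣ →
  n + suc m ≤ ∣ S ∪ T ∣ → ∃ λ b → b ∈ T × n ≤ ∣ S - b ∣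
removablePoint S T {n} {m} n≤∣S∣ m<∣T∣ n+m<∣S∪T∣ with nonempty? (T ─ S)
... | yes (b , b∈T─S) = b , p─q⊆p T S b∈T─S , ≤-trans n≤∣S∣ (p⊆q⇒∣p∣≤∣q∣ S⊆S-b)
  where
  S⊆S-b : S ⊆ S - b
  S⊆S-b {a} a∈S = x∈p∧x≢y⇒x∈p-y a∈S λ { refl → x∈p─q⇒x∉q T S b∈T─S a∈S }
... | no T⊆S with nonempty T (≤-trans (s≤s z≤n) m<∣T∣)
...   | b , b∈T = b , b∈T , +-cancelʳ-≤ m n ∣ S - b ∣ (s≤s⁻¹ (begin
  suc (n + m)      ≡⟨ +-suc n m ⟨
  n + suc m        ≤⟨ n+m<∣S∪T∣ ⟩
  ∣ S ∪ T ∣        ≤⟨ p⊆q⇒∣p∣≤∣q∣ S∪T⊆S ⟩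
  ∣ S ∣            ≤⟨ ∣p∣≤1+∣p-x∣ S b ⟩
  suc ∣ S - b ∣    ≤⟨ s≤s (m≤m+n ∣ S - b ∣ m) ⟩
  suc (∣ S - b ∣ + m) ∎))
  where
  open ≤-Reasoning
  S∪T⊆S : S ∪ T ⊆ S
  S∪T⊆S {x} x∈ with x∈p∪q⁻ S T x∈
  ... | inj₁ x∈S = x∈S
  ... | inj₂ x∈T with x ∈? S
  ...   | yes x∈S = x∈S
  ...   | no x∉S  = ⊥-elim (T⊆S (x , x∈p∧x∉q⇒x∈p─q x∈T x∉S))

disjointChoice : (S T : Subset k) {n m : ℕ} → n ≤ ∣ S ∣ → m ≤ ∣ T ∣ →
  n + m ≤ ∣ S ∪ T ∣ → DisjointChoice S T n m
disjointChoice S T {m = zero} n≤∣S∣ _ _ with choose S n≤∣S∣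
... | f , f-inj , f∈S = record
  { left = f ; right = λ () ; left-inj = f-inj ; right-inj = empty-injective
  ; left∈S = f∈S ; right∈T = λ () ; apart = λ _ () }
disjointChoice S T {n} {suc m} n≤∣S∣ m<∣T∣ n+m<∣S∪T∣ with removablePoint S T n≤∣S∣ m<∣T∣ n+m<∣S∪T∣
... | b , b∈T , n≤∣S-b∣ = adjoinRight b∈T (disjointChoice (S - b) (T - b) n≤∣S-b∣ m≤∣T-b∣ n+m≤∣S-b∪T-b∣)
  where
  m≤∣T-b∣ : m ≤ ∣ T - b ∣
  m≤∣T-b∣ = s≤s⁻¹ (≤-trans m<∣T∣ (∣p∣≤1+∣p-x∣ T b))
  n+m≤∣S-b∪T-b∣ : n + m ≤ ∣ (S - b) ∪ (T - b) ∣
  n+m≤∣S-b∪T-b∣ = s≤s⁻¹ (≤-trans (≤-reflexive (sym (+-suc n m)))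
                        (≤-trans n+m<∣S∪T∣ (∣p∪q∣≤1+∣p-x∪q-x∣ S T b)))

nbhdA : {n m : ℕ} → Fin (suc n) → DSVertex n m
nbhdA zero    = cb
nbhdA (suc i) = la i

nbhdB : {n m : ℕ} → Fin (suc m) → DSVertex n m
nbhdB zero    = ca
nbhdB (suc j) = lb j

-- Every vertex is a neighbour of exactly one centre; this records which.
vertexCode : {n m : ℕ} → DSVertex n m → Fin (suc n) ⊎ Fin (suc m)
vertexCode ca     = inj₂ zero
vertexCode cb     = inj₁ zero
vertexCode (la i) = inj₁ (suc i)
vertexCode (lb j) = inj₂ (suc j)

vertexCode-nbhd : {n m : ℕ} (s : Fin (suc n) ⊎ Fin (suc m)) →
  vertexCode ([ nbhdA , nbhdB ]′ s) ≡ s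
vertexCode-nbhd (inj₁ zero)    = refl
vertexCode-nbhd (inj₁ (suc i)) = refl
vertexCode-nbhd (inj₂ zero)    = refl
vertexCode-nbhd (inj₂ (suc j)) = refl

nbhdA-injective : {n m : ℕ} → Injective _≡_ _≡_ (nbhdA {n} {m})
nbhdA-injective = retraction⇒injective nbhdA (fromInj₁ (λ _ → zero) ∘ vertexCode)
  (λ i → cong (fromInj₁ (λ _ → zero)) (vertexCode-nbhd (inj₁ i)))

enumerate : {n m : ℕ} → Fin (suc n + suc m) → DSVertex n m
enumerate {n} = [ nbhdA , nbhdB ]′ ∘ splitAt (suc n)

enumerate-injective : {n m : ℕ} → Injective _≡_ _≡_ (enumerate {n} {m})
enumerate-injective {n} {m} = retraction⇒injective enumerate (join (suc n) (suc m) ∘ vertexCode)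
  (λ i → trans (cong (join (suc n) (suc m)) (vertexCode-nbhd (splitAt (suc n) i)))
               (join-splitAt (suc n) (suc m) i))

∈-tabulate⌊⌋ : {P : Fin k → Set} (P? : ∀ x → Dec (P x)) {x : Fin k} →
  x ∈ tabulate (λ y → ⌊ P? y ⌋) ⇔ P x
∈-tabulate⌊⌋ P? {x} = mk⇔
  (λ x∈ → toWitness (T-≡ .from (trans (sym (lookup∘tabulate _ x)) ([]=⇒lookup x∈))))
  (λ Px → lookup⇒[]= x _ (trans (lookup∘tabulate _ x) (T-≡ .to (fromWitness Px))))

other : Colour → Colour
other B = R
other R = B

other-colour : (c C : Colour) → c ≢ C → c ≡ other C
other-colour B B c≢C = ⊥-elim (c≢C refl)
other-colour B R _   = refl
other-colour R B _   = refl
other-colour R R c≢C = ⊥-elim (c≢C refl)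

module _ {p : ℕ} (col : Colouring p) where

  ∈N⇔ : {C : Colour} {u w : Fin p} → w ∈ N col C u ⇔ (w ≢ u × col u w ≡ C)
  ∈N⇔ {C} {u} = ∈-tabulate⌊⌋ λ w → ¬? (w ≟ u) ×-dec (col u w ≟ᶜ C)

  ∈N⁺ : {C : Colour} {u w : Fin p} → w ≢ u → col u w ≡ C → w ∈ N col C u
  ∈N⁺ w≢u uw∈C = ∈N⇔ .from (w≢u , uw∈C)

  u∉N[u] : {C : Colour} (u : Fin p) → u ∉ N col C u
  u∉N[u] u u∈N[u] = proj₁ (∈N⇔ .to u∈N[u]) refl

  -- Every other vertex is a neighbour of x in one of the two colours, so
  -- p ≤ 1 + deg_C(x) + deg_{other C}(x).
  degree-sum : (C : Colour) (x : Fin p) → p ≤ suc (deg col C x + deg col (other C) x)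
  degree-sum C x = begin
    p                                                ≡⟨ ∣⊤∣≡n p ⟨
    ∣ ⊤ {p} ∣                                        ≤⟨ p⊆q⇒∣p∣≤∣q∣ ⊤⊆ ⟩
    ∣ ⁅ x ⁆ ∪ (N col C x ∪ N col (other C) x) ∣      ≤⟨ ∣⁅x⁆∪p∣≤1+∣p∣ x (N col C x ∪ N col (other C) x) ⟩
    suc ∣ N col C x ∪ N col (other C) x ∣            ≤⟨ s≤s (∣p∪q∣≤∣p∣+∣q∣ (N col C x) (N col (other C) x)) ⟩
    suc (deg col C x + deg col (other C) x)          ∎
    where
    open ≤-Reasoning
    ⊤⊆ : ⊤ {p} ⊆ ⁅ x ⁆ ∪ (N col C x ∪ N col (other C) x)
    ⊤⊆ {y} _ with y ≟ x | col x y ≟ᶜ C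
    ... | yes refl | _        = x∈p∪q⁺ (inj₁ (x∈⁅x⁆ x))
    ... | no y≢x   | yes xy∈C = x∈p∪q⁺ (inj₂ (x∈p∪q⁺ (inj₁ (∈N⁺ y≢x xy∈C))))
    ... | no y≢x   | no xy∉C  =
      x∈p∪q⁺ (inj₂ (x∈p∪q⁺ (inj₂ (∈N⁺ y≢x (other-colour _ C xy∉C)))))

  complement-degree : (C : Colour) (x : Fin p) {a d : ℕ} →
    deg col C x ≤ a → a + d < p → d ≤ deg col (other C) x
  complement-degree C x {a} {d} degC≤a a+d<p = +-cancelˡ-≤ a d (deg col (other C) x) (s≤s⁻¹ (begin
    suc (a + d)                                ≤⟨ a+d<p ⟩
    p                                          ≤⟨ degree-sum C x ⟩
    suc (deg col C x + deg col (other C) x)    ≤⟨ s≤s (+-monoˡ-≤ (deg col (other C) x) degC≤a) ⟩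
    suc (a + deg col (other C) x)              ∎))
    where open ≤-Reasoning

  embedStar : {C : Colour} {n m : ℕ} {u w : Fin p} → u ≢ w → col u w ≡ C →
    DisjointChoice (N col C u - w) (N col C w - u) n m → MonoDoubleStar col C n m
  embedStar {C} {n} {m} {u} {w} u≢w uw∈C c = F , F-injective , F-edge
    where
    open DisjointChoice c
    left-nbr : ∀ i → left i ≢ u × col u (left i) ≡ C
    left-nbr i = ∈N⇔ .to (x∈p-y⇒x∈p (left∈S i))
    right-nbr : ∀ j → right j ≢ w × col w (right j) ≡ C
    right-nbr j = ∈N⇔ .to (x∈p-y⇒x∈p (right∈T j))

    F : DSVertex n m → Fin p
    F ca     = u
    F cb     = w
    F (la i) = left i
    F (lb j) = right j

    at-u : ∀ x → F x ≡ u → x ≡ ca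
    at-u ca     _   = refl
    at-u cb     w≡u = ⊥-elim (u≢w (sym w≡u))
    at-u (la i) e   = ⊥-elim (proj₁ (left-nbr i) e)
    at-u (lb j) e   = ⊥-elim (x∈p-y⇒x≢y (right∈T j) e)
    at-w : ∀ x → F x ≡ w → x ≡ cb
    at-w ca     u≡w = ⊥-elim (u≢w u≡w)
    at-w cb     _   = refl
    at-w (la i) e   = ⊥-elim (x∈p-y⇒x≢y (left∈S i) e)
    at-w (lb j) e   = ⊥-elim (proj₁ (right-nbr j) e)

    F-injective : Injective _≡_ _≡_ F
    F-injective {ca}   {y}    e = sym (at-u y (sym e))
    F-injective {cb}   {y}    e = sym (at-w y (sym e))
    F-injective {la i} {ca}   e = at-u (la i) e
    F-injective {la i} {cb}   e = at-w (la i) e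
    F-injective {la i} {la j} e = cong la (left-inj e)
    F-injective {la i} {lb j} e = ⊥-elim (apart i j e)
    F-injective {lb j} {ca}   e = at-u (lb j) e
    F-injective {lb j} {cb}   e = at-w (lb j) e
    F-injective {lb j} {la i} e = ⊥-elim (apart i j (sym e))
    F-injective {lb j} {lb k} e = cong lb (right-inj e)

    F-edge : ∀ x y → DSEdge x y → col (F x) (F y) ≡ C
    F-edge _ _ centre    = uw∈C
    F-edge _ _ (leafa i) = proj₂ (left-nbr i)
    F-edge _ _ (leafb j) = proj₂ (right-nbr j)

  buildStar : {C : Colour} {n m : ℕ} {u w : Fin p} → u ≢ w → col u w ≡ C →
    n < deg col C u → m < deg col C w → suc (n + m) < ∣ N col C u ∪ N col C w ∣ →
    MonoDoubleStar col C n m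
  buildStar {C} {n} {m} {u} {w} u≢w uw∈C n<deg[u] m<deg[w] n+m+1<∣Nu∪Nw∣ =
    embedStar u≢w uw∈C (disjointChoice (N col C u - w) (N col C w - u)
      (s≤s⁻¹ (≤-trans n<deg[u] (∣p∣≤1+∣p-x∣ (N col C u) w)))
      (s≤s⁻¹ (≤-trans m<deg[w] (∣p∣≤1+∣p-x∣ (N col C w) u)))
      (s≤s⁻¹ (s≤s⁻¹ (≤-trans n+m+1<∣Nu∪Nw∣ (∣p∪q∣≤2+∣p-y∪q-x∣ (N col C u) (N col C w) u w)))))

  -- For a C-edge uw with deg_C u > n, either uw is the centre edge of a
  -- C-coloured S(n,m), or deg_C w ≤ n + m: if |N_C u ∪ N_C w| ≤ n + m + 1,
  -- then N_C w misses the point w of that union.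
  starOrLowDegree : {C : Colour} {n m : ℕ} {u w : Fin p} → w ∈ N col C u →
    n < deg col C u → MonoDoubleStar col C n m ⊎ deg col C w ≤ n + m
  starOrLowDegree {C} {n} {m} {u} {w} w∈N[u] n<deg[u]
    with m <? deg col C w | suc (n + m) <? ∣ N col C u ∪ N col C w ∣
  ... | yes m<deg[w] | yes big =
    inj₁ (buildStar (proj₁ (∈N⇔ .to w∈N[u]) ∘ sym) (proj₂ (∈N⇔ .to w∈N[u])) n<deg[u] m<deg[w] big)
  ... | no m≮deg[w] | _ = inj₂ (≤-trans (≮⇒≥ m≮deg[w]) (m≤n+m m n))
  ... | yes _ | no small = inj₂ (s≤s⁻¹ (begin-strict
    deg col C w                <⟨ ∣p∣<∣p∪q∣ (N col C w) (N col C u) w∈N[u] (u∉N[u] w) ⟩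
    ∣ N col C w ∪ N col C u ∣  ≡⟨ cong ∣_∣ (∪-comm (N col C w) (N col C u)) ⟩
    ∣ N col C u ∪ N col C w ∣  ≤⟨ ≮⇒≥ small ⟩
    suc (n + m)                ∎))
    where open ≤-Reasoning

  module _ (symm : Symmetric col) where

    ∈N-sym : {C : Colour} {u w : Fin p} → w ∈ N col C u → u ∈ N col C w
    ∈N-sym w∈N[u] with ∈N⇔ .to w∈N[u]
    ... | w≢u , uw∈C = ∈N⁺ (w≢u ∘ sym) (trans (symm _ _ w≢u) uw∈C)

    module StarSizes {C : Colour} {n m : ℕ} (F : DSVertex n m → Fin p)
      (F-injective : Injective _≡_ _≡_ F)
      (F-edge : ∀ x y → DSEdge x y → col (F x) (F y) ≡ C) where

      edge⇒∈N : {x y : DSVertex n m} → DSEdge x y → F y ∈ N col C (F x)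
      edge⇒∈N {x} {y} e = ∈N⁺ (λ Fy≡Fx → ends-differ e (F-injective Fy≡Fx)) (F-edge x y e)
        where
        ends-differ : {x y : DSVertex n m} → DSEdge x y → y ≢ x
        ends-differ centre    ()
        ends-differ (leafa i) ()
        ends-differ (leafb j) ()

      nbhdA∈N : ∀ i → F (nbhdA i) ∈ N col C (F ca)
      nbhdA∈N zero    = edge⇒∈N centre
      nbhdA∈N (suc i) = edge⇒∈N (leafa i)

      nbhdB∈N : ∀ j → F (nbhdB j) ∈ N col C (F cb)
      nbhdB∈N zero    = ∈N-sym (edge⇒∈N centre)
      nbhdB∈N (suc j) = edge⇒∈N (leafb j)

      n<deg : n < deg col C (F ca)
      n<deg = injection⇒≤∣p∣ (N col C (F ca)) (F ∘ nbhdA) (nbhdA-injective ∘ F-injective) nbhdA∈N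

      n+m+2≤∣N∪N∣ : suc n + suc m ≤ ∣ N col C (F ca) ∪ N col C (F cb) ∣
      n+m+2≤∣N∪N∣ = injection⇒≤∣p∣ _ (F ∘ enumerate) (enumerate-injective ∘ F-injective)
        (λ i → near (splitAt (suc n) i))
        where
        near : ∀ s → F ([ nbhdA , nbhdB ]′ s) ∈ N col C (F ca) ∪ N col C (F cb)
        near (inj₁ i) = x∈p∪q⁺ (inj₁ (nbhdA∈N i))
        near (inj₂ j) = x∈p∪q⁺ (inj₂ (nbhdB∈N j))

    condition⇒free : {n m : ℕ} → Condition col n m → Free col n m
    condition⇒free {n} {m} cond C (F , F-injective , F-edge) =
      [ <⇒≱ (<-≤-trans (n+m+1<2+n+m n m) n+m+2≤∣N∪N∣) , <⇒≱ n<deg ∘ proj₁ ]′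
      (cond C (F ca) (F cb) (λ Fca≡Fcb → ca≢cb (F-injective Fca≡Fcb)) (F-edge ca cb centre))
      where
      open StarSizes F F-injective F-edge
      ca≢cb : ca ≢ cb
      ca≢cb ()

    module _ {n m : ℕ} (hp : n + 2 * m + 2 ≤ p) where

      -- If deg_C v ≤ m and deg_C w ≤ n + m, then v and w have many neighbours
      -- in the other colour D, and an edge vw of colour D is the centre edge
      -- of a D-coloured S(n,m).
      otherColourStar : {C : Colour} {v w : Fin p} → w ≢ v → col v w ≡ other C →
        deg col C v ≤ m → deg col C w ≤ n + m → MonoDoubleStar col (other C) n m
      otherColourStar {C} {v} {w} w≢v vw∈D deg[v]≤m deg[w]≤n+m =
        buildStar (w≢v ∘ sym) vw∈D (≤-trans (s≤s (m≤m+n n m)) n+m<degD[v]) m<degD[w] big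
        where
        n+m<degD[v] : suc (n + m) ≤ deg col (other C) v
        n+m<degD[v] = complement-degree C v deg[v]≤m (room-after-m hp)
        m<degD[w] : suc m ≤ deg col (other C) w
        m<degD[w] = complement-degree C w deg[w]≤n+m (room-after-n+m hp)
        big : suc (n + m) < ∣ N col (other C) v ∪ N col (other C) w ∣
        big = ≤-<-trans n+m<degD[v]
          (∣p∣<∣p∪q∣ (N col (other C) v) (N col (other C) w) (∈N-sym (∈N⁺ w≢v vw∈D)) (u∉N[u] v))

      -- If v has
      -- few C-neighbours, u has a C-neighbour w ≠ v that is not one of them.
      forcedStar : {C : Colour} {u v : Fin p} → u ≢ v → col u v ≡ C →
        n < deg col C u → suc (n + m) < ∣ N col C u ∪ N col C v ∣ →
        ∃ λ D → MonoDoubleStar col D n m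
      forcedStar {C} {u} {v} u≢v uv∈C n<deg[u] big with m <? deg col C v
      ... | yes m<deg[v] = C , buildStar u≢v uv∈C n<deg[u] m<deg[v] big
      ... | no m≮deg[v]
        with privatePoint (N col C u) (N col C v) v
               (≤-trans (s≤s (s≤s (≤-trans (≮⇒≥ m≮deg[v]) (m≤n+m m n)))) big)
      ...   | w , w∈N[u] , w∉N[v] , w≢v with starOrLowDegree {m = m} w∈N[u] n<deg[u]
      ...     | inj₁ star = C , star
      ...     | inj₂ deg[w]≤n+m = other C ,
        otherColourStar w≢v (other-colour _ C (w∉N[v] ∘ ∈N⁺ w≢v)) (≮⇒≥ m≮deg[v]) deg[w]≤n+m

      free⇒low-degree : Free col n m → {C : Colour} {u v : Fin p} → u ≢ v →
        col u v ≡ C → suc (n + m) < ∣ N col C u ∪ N col C v ∣ → deg col C u ≤ n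
      free⇒low-degree free u≢v uv∈C big with deg col _ _ ≤? n
      ... | yes deg[u]≤n = deg[u]≤n
      ... | no deg[u]≰n  = ⊥-elim (uncurry free (forcedStar u≢v uv∈C (≰⇒> deg[u]≰n) big))

      free⇒condition : Free col n m → Condition col n m
      free⇒condition free C u v u≢v uv∈C with ∣ N col C u ∪ N col C v ∣ ≤? n + m + 1
      ... | yes small = inj₁ small
      ... | no large  = inj₂
        ( free⇒low-degree free u≢v uv∈C big
        , free⇒low-degree free (u≢v ∘ sym) (trans (symm v u (u≢v ∘ sym)) uv∈C)
            (subst (suc (n + m) <_) (cong ∣_∣ (∪-comm (N col C u) (N col C v))) big) )
        where
        big : suc (n + m) < ∣ N col C u ∪ N col C v ∣
        big = subst (_< ∣ N col C u ∪ N col C v ∣) (+-comm (n + m) 1) (≰⇒> large)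

lemma2p2 : (n m p : ℕ) → m ≤ n → n + 2 * m + 2 ≤ p →
    (col : Colouring p) → Symmetric col →
    Free col n m ⇔ Condition col n m
lemma2p2 n m p _ hp col symm = mk⇔ (free⇒condition col symm hp) (condition⇒free col symm)
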